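{- Let $Y$ be a connected finite simple undirected graph with vertex set $\{1,\dots,n\}$, let $\pi\in S_Y$, and let $g,g'\in D_n$ with $g\neq g'$. If $[g\cdot\pi]_Y=[g'\cdot\pi]_Y$, then $Y$ is bipartite.
   Context: $S_Y$ denotes the set of permutations (total orders) $\pi=(\pi_1,\dots,\pi_n)$ of the vertex set of $Y$. The update graph $U(Y)$ has vertex set $S_Y$, and two permutations are adjacent if they differ exactly by swapping two consecutive entries $\pi_k,\pi_{k+1}$ with $\{\pi_k,\pi_{k+1}\}$ not an edge of $Y$. Write $\pi\sim_Y\pi'$ if $\pi,\pi'$ lie in the same connected component of $U(Y)$, and $[\pi]_Y$ for the class of $\pi$. In cycle notation let $\sigma=(n,n-1,\dots,2,1)$ and $\rho=(1,n)(2,n-1)\cdots(\lceil n/2\rceil,\lfloor n/2\rfloor+1)$ in $S_n$, and $D_n=\langle\sigma,\rho\rangle$. The group $S_n$ acts on $S_Y$ by $g\cdot(\pi_1,\dots,\pi_n)=(\pi_{g^{ -1}(1)},\dots,\pi_{g^{ -1}(n)})$; thus $\sigma\cdot\pi=(\pi_2,\dots,\pi_n,\pi_1)$ and $\rho\cdot\pi=(\pi_n,\dots,\pi_1)$. -}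

module Defs where

open import Data.Nat using (ℕ; zero; suc)
open import Data.Fin using (Fin; zero; suc; toℕ; fromℕ; inject₁; opposite)
open import Data.Bool using (Bool)
open import Data.Product using (Σ; _×_; ∃)
open import Relation.Binary.PropositionalEquality using (_≡_; _≢_)
open import Relation.Binary.Core using (Rel)
open import Relation.Binary.Definitions using (Decidable; Symmetric)
open import Relation.Binary.Construct.Closure.ReflexiveTransitive using (Star)
open import Relation.Nullary using (¬_)
open import Function.Definitions using (Injective)
open import Level using (0ℓ)

-- Vertex set {1,…,n} is modelled by Fin n (vertex i+1 ↔ index i).

record SimpleGraph (n : ℕ) : Set₁ where
  field
    Adj     : Rel (Fin n) 0ℓ
    adj?    : Decidable Adj
    sym     : Symmetric Adj
    irrefl  : ∀ v → ¬ Adj v v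

open SimpleGraph public

Connected : ∀ {n} → SimpleGraph n → Set
Connected {n} Y = ∀ (u v : Fin n) → Star (Adj Y) u v

Bipartite : ∀ {n} → SimpleGraph n → Set
Bipartite {n} Y = Σ (Fin n → Bool) λ c → ∀ u v → Adj Y u v → c u ≢ c v

-- A total order π = (π₁,…,πₙ) of the vertices: π k is the vertex at position k.
-- S_Y = injective (hence bijective) maps Fin n → Fin n.
IsPerm : ∀ {n} → (Fin n → Fin n) → Set
IsPerm π = Injective _≡_ _≡_ π

-- Adjacency in the update graph U(Y): π' arises from π by swapping the entries at
-- consecutive positions i, j (toℕ j = toℕ i + 1) and {π i, π j} is not an edge of Y.
UAdj : ∀ {n} → SimpleGraph n → Rel (Fin n → Fin n) 0ℓ
UAdj {n} Y π π' =
  Σ (Fin n) λ i → Σ (Fin n) λ j →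
    (toℕ j ≡ suc (toℕ i)) ×
    (¬ Adj Y (π i) (π j)) ×
    (π' i ≡ π j) × (π' j ≡ π i) ×
    (∀ l → l ≢ i → l ≢ j → π' l ≡ π l)

-- π ∼_Y π' : same connected component of U(Y) (up to pointwise equality of maps).
SameClass : ∀ {n} → SimpleGraph n → Rel (Fin n → Fin n) 0ℓ
SameClass {n} Y π π' =
  Σ (Fin n → Fin n) λ ρ → Star (UAdj Y) π ρ × (∀ k → ρ k ≡ π' k)

-- σ = (n, n-1, …, 2, 1): 1 ↦ n, k ↦ k-1 (in 0-indexed Fin: 0 ↦ n-1, k+1 ↦ k).
σ : ∀ {n} → Fin n → Fin n
σ {suc m} zero    = fromℕ m
σ {suc m} (suc i) = inject₁ i

ρ : ∀ {n} → Fin n → Fin n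
ρ = opposite

-- D_n = ⟨σ, ρ⟩: maps generated from the identity by composing with σ and ρ
-- (the group is finite, so this monoid generated is the generated group).
data InD {n : ℕ} : (Fin n → Fin n) → Set where
  d-id : InD (λ i → i)
  d-σ  : ∀ {g} → InD g → InD (λ i → σ (g i))
  d-ρ  : ∀ {g} → InD g → InD (λ i → ρ (g i))

-- The action g·π = (π_{g⁻¹(1)},…,π_{g⁻¹(n)}), characterised by (g·π)(g(k)) = π(k).
IsAct : ∀ {n} → (g π gπ : Fin n → Fin n) → Set
IsAct g π gπ = ∀ k → gπ (g k) ≡ π k

-- Moves in U(Y) only swap neighbours that are not adjacent in Y, so the orientation of Y
-- induced by π (each edge points away from the vertex coming first) is constant on [π]_Y.
-- Every g ∈ D_n changes the relative order of two positions a ≠ b exactly when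
-- e ⊕ c(a) ⊕ c(b) = 1, for a global bit e (does g reverse?) and a position colouring c
-- (σ flips precisely the pairs containing the first position, ρ flips all pairs).
-- If g·π ∼_Y g'·π, both orient every edge alike, so the colouring d = c ⊕ c' transported to
-- the vertices satisfies d(u) ⊕ d(v) = e ⊕ e' on every edge uv.  For e ≠ e' this is a proper
-- 2-colouring of Y.  For e = e' it makes d constant on the connected graph Y, hence g and g'
-- order all positions alike, which forces g = g'.
module Submission where

open import Defs renaming (sym to Adj-sym)
open import Data.Nat using (ℕ)
open import Data.Fin using (Fin)
open import Relation.Binary.PropositionalEquality using (_≡_)
open import Relation.Nullary using (¬_)

open import Data.Bool using (Bool; true; false; _xor_)
open import Data.Bool.Properties using (xor-same; xor-∧-commutativeRing; not-injective; T-≡)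
open import Function.Bundles using (Equivalence; _⇔_; mk⇔)
open import Data.Fin using (zero; suc; toℕ; fromℕ; fromℕ<; inject₁; opposite; punchOut; _≟_)
open import Data.Fin.Properties
  using (toℕ-injective; toℕ<n; toℕ-fromℕ<; toℕ-inject₁; inject₁-injective; fromℕ≢inject₁;
         opposite-involutive; any?; injective⇒≤; punchOut-injective)
open import Data.Maybe using (Maybe; just; nothing)
import Data.Nat as ℕ
open import Data.Nat.Properties
  using (<ᵇ⇒<; <⇒<ᵇ; <-cmp; <-irrefl; <-asym; <-trans; ≤-reflexive; ≤-<-trans; <⇒≤; ≤⇒≯; ≤∧≢⇒<;
         ≤-antisym; ≤-refl; n<1+n)
open import Data.Product using (∃; ∃₂; _×_; _,_; proj₁; proj₂)
open import Function using (_∘_; id; const)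
open import Function.Definitions using (Injective)
open import Relation.Binary.Construct.Closure.ReflexiveTransitive using (Star; ε; _◅_)
open import Relation.Binary.Definitions using (tri<; tri≈; tri>)
open import Relation.Binary.PropositionalEquality
  using (_≢_; refl; sym; trans; cong; subst; subst₂; module ≡-Reasoning)
open import Relation.Nullary using (yes; no; contradiction)
open import Tactic.RingSolver using (solve-∀)
open import Tactic.RingSolver.Core.AlmostCommutativeRing using (AlmostCommutativeRing; fromCommutativeRing)

private
  variable
    n : ℕ

𝔽₂ : AlmostCommutativeRing _ _
𝔽₂ = fromCommutativeRing xor-∧-commutativeRing isZero
  where
  -- the zero test is what lets the ring solver cancel x xor x
  isZero : (x : Bool) → Maybe (false ≡ x)
  isZero false = just refl
  isZero true  = nothing

xor-≡-false : ∀ {p q} → p xor q ≡ false → p ≡ q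
xor-≡-false {false} eq = sym eq
xor-≡-false {true}  eq = not-injective (sym eq)

xor-≡-true : ∀ {p q} → p xor q ≡ true → p ≢ q
xor-≡-true {p} eq refl = contradiction (trans (sym eq) (xor-same p)) λ ()

≡⇒xor-≡-false : ∀ {p q} → p ≡ q → p xor q ≡ false
≡⇒xor-≡-false {p} refl = xor-same p

xor-twists : ∀ e e' x x' y y' l →
  (e xor (x xor y) xor l) xor (e' xor (x' xor y') xor l) ≡ (e xor e') xor ((x xor x') xor (y xor y'))
xor-twists = solve-∀ 𝔽₂

xor-compose : ∀ e' x' y' e x y l →
  e' xor (x' xor y') xor (e xor (x xor y) xor l) ≡ (e' xor e) xor ((x' xor x) xor (y' xor y)) xor l
xor-compose = solve-∀ 𝔽₂

infix 4 _<ᵇ_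

_<ᵇ_ : Fin n → Fin n → Bool
a <ᵇ b = toℕ a ℕ.<ᵇ toℕ b

<⇒<ᵇ≡true : ∀ {a b : Fin n} → toℕ a ℕ.< toℕ b → (a <ᵇ b) ≡ true
<⇒<ᵇ≡true a<b = Equivalence.to T-≡ (<⇒<ᵇ a<b)

<ᵇ≡true⇒< : ∀ {a b : Fin n} → (a <ᵇ b) ≡ true → toℕ a ℕ.< toℕ b
<ᵇ≡true⇒< {a = a} {b} eq = <ᵇ⇒< (toℕ a) (toℕ b) (Equivalence.from T-≡ eq)

≤⇒<ᵇ≡false : ∀ {a b : Fin n} → toℕ b ℕ.≤ toℕ a → (a <ᵇ b) ≡ false
≤⇒<ᵇ≡false {a = a} {b} b≤a with a <ᵇ b in eq
... | false = refl
... | true  = contradiction (<ᵇ≡true⇒< eq) (≤⇒≯ b≤a)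

<ᵇ-irrefl : ∀ (a : Fin n) → (a <ᵇ a) ≡ false
<ᵇ-irrefl a = ≤⇒<ᵇ≡false {a = a} ≤-refl

<ᵇ-transport : ∀ {x y x' y' : Fin n} → x ≢ y →
  (toℕ x ℕ.< toℕ y → toℕ x' ℕ.< toℕ y') → (toℕ y ℕ.< toℕ x → toℕ y' ℕ.< toℕ x') →
  (x <ᵇ y) ≡ (x' <ᵇ y')
<ᵇ-transport {x = x} {y} x≢y ⇒< ⇒> with <-cmp (toℕ x) (toℕ y)
... | tri< x<y _ _ = trans (<⇒<ᵇ≡true x<y) (sym (<⇒<ᵇ≡true (⇒< x<y)))
... | tri≈ _ x≡y _ = contradiction (toℕ-injective x≡y) x≢y
... | tri> _ _ y<x = trans (≤⇒<ᵇ≡false (<⇒≤ y<x)) (sym (≤⇒<ᵇ≡false (<⇒≤ (⇒> y<x))))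

injective⇒onto : ∀ {f : Fin n → Fin n} → Injective _≡_ _≡_ f → ∀ y → ∃ λ x → f x ≡ y
injective⇒onto {ℕ.suc m} {f} f-inj y with any? (λ x → f x ≟ y)
... | yes found = found
... | no  ¬found = contradiction (injective⇒≤ punchOut-injective′) (<-irrefl refl)
  where
  y≢f : ∀ x → y ≢ f x
  y≢f x y≡fx = ¬found (x , sym y≡fx)
  punchOut-injective′ : Injective _≡_ _≡_ (λ x → punchOut (y≢f x))
  punchOut-injective′ = f-inj ∘ punchOut-injective (y≢f _) (y≢f _)

-- Every value below g a is some g b with g b < g a, hence g' b < g' a: induction on toℕ (g a).
onto∧order-preserving⇒≤ : ∀ (g g' : Fin n → Fin n) → (∀ y → ∃ λ x → g x ≡ y) →
  (∀ a b → toℕ (g a) ℕ.< toℕ (g b) → toℕ (g' a) ℕ.< toℕ (g' b)) →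
  ∀ a → toℕ (g a) ℕ.≤ toℕ (g' a)
onto∧order-preserving⇒≤ {n} g g' g-onto preserves a = go (toℕ (g a)) a refl
  where
  go : ∀ k a → toℕ (g a) ≡ k → k ℕ.≤ toℕ (g' a)
  go ℕ.zero    _ _   = ℕ.z≤n
  go (ℕ.suc k) a ga≡1+k = ≤-<-trans (go k b gb≡k) (preserves b a gb<ga)
    where
    k<n : k ℕ.< n
    k<n = <-trans (n<1+n k) (subst (ℕ._< n) ga≡1+k (toℕ<n (g a)))
    b : Fin n
    b = proj₁ (g-onto (fromℕ< k<n))
    gb≡k : toℕ (g b) ≡ k
    gb≡k = trans (cong toℕ (proj₂ (g-onto (fromℕ< k<n)))) (toℕ-fromℕ< k<n)
    gb<ga : toℕ (g b) ℕ.< toℕ (g a)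
    gb<ga = subst₂ ℕ._<_ (sym gb≡k) (sym ga≡1+k) (n<1+n k)

<ᵇ-agreement⇒order-preserving : ∀ (g g' : Fin n → Fin n) → (∀ a b → (g a <ᵇ g b) ≡ (g' a <ᵇ g' b)) →
  ∀ a b → toℕ (g a) ℕ.< toℕ (g b) → toℕ (g' a) ℕ.< toℕ (g' b)
<ᵇ-agreement⇒order-preserving g g' same a b ga<gb =
  <ᵇ≡true⇒< {a = g' a} (trans (sym (same a b)) (<⇒<ᵇ≡true {a = g a} ga<gb))

<ᵇ-determines : ∀ {g g' : Fin n → Fin n} → Injective _≡_ _≡_ g → Injective _≡_ _≡_ g' →
  (∀ a b → (g a <ᵇ g b) ≡ (g' a <ᵇ g' b)) → ∀ a → g a ≡ g' a
<ᵇ-determines {g = g} {g'} g-inj g'-inj same a = toℕ-injective (≤-antisym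
  (onto∧order-preserving⇒≤ g g' (injective⇒onto g-inj) (<ᵇ-agreement⇒order-preserving g g' same) a)
  (onto∧order-preserving⇒≤ g' g (injective⇒onto g'-inj)
    (<ᵇ-agreement⇒order-preserving g' g (λ x y → sym (same x y))) a))

record Reorders (f : Fin n → Fin n) (e : Bool) (c : Fin n → Bool) : Set where
  field
    <ᵇ-reorder : ∀ a b → a ≢ b → (f a <ᵇ f b) ≡ e xor (c a xor c b) xor (a <ᵇ b)

open Reorders

id-Reorders : Reorders {n} id false (const false)
id-Reorders .<ᵇ-reorder _ _ _ = refl

∘-Reorders : ∀ {f h : Fin n → Fin n} {e e' c c'} → Injective _≡_ _≡_ f →
  Reorders f e c → Reorders h e' c' → Reorders (h ∘ f) (e' xor e) (λ a → c' (f a) xor c a)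
∘-Reorders {f = f} {h} {e} {e'} {c} {c'} f-inj f-reorders h-reorders .<ᵇ-reorder a b a≢b = begin
  h (f a) <ᵇ h (f b)
    ≡⟨ h-reorders .<ᵇ-reorder (f a) (f b) (a≢b ∘ f-inj) ⟩
  e' xor (c' (f a) xor c' (f b)) xor (f a <ᵇ f b)
    ≡⟨ cong (λ l → e' xor (c' (f a) xor c' (f b)) xor l) (f-reorders .<ᵇ-reorder a b a≢b) ⟩
  e' xor (c' (f a) xor c' (f b)) xor (e xor (c a xor c b) xor (a <ᵇ b))
    ≡⟨ xor-compose e' (c' (f a)) (c' (f b)) e (c a) (c b) (a <ᵇ b) ⟩
  (e' xor e) xor ((c' (f a) xor c a) xor (c' (f b) xor c b)) xor (a <ᵇ b) ∎
  where open ≡-Reasoning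

isZero : Fin n → Bool
isZero zero    = true
isZero (suc _) = false

fromℕ-<ᵇ-inject₁ : ∀ {m} (j : Fin m) → (fromℕ m <ᵇ inject₁ j) ≡ false
fromℕ-<ᵇ-inject₁ zero    = refl
fromℕ-<ᵇ-inject₁ (suc j) = fromℕ-<ᵇ-inject₁ j

inject₁-<ᵇ-fromℕ : ∀ {m} (i : Fin m) → (inject₁ i <ᵇ fromℕ m) ≡ true
inject₁-<ᵇ-fromℕ zero    = refl
inject₁-<ᵇ-fromℕ (suc i) = inject₁-<ᵇ-fromℕ i

inject₁-<ᵇ-inject₁ : ∀ {m} (i j : Fin m) → (inject₁ i <ᵇ inject₁ j) ≡ (i <ᵇ j)
inject₁-<ᵇ-inject₁ i j rewrite toℕ-inject₁ i | toℕ-inject₁ j = refl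

σ-Reorders : Reorders {n} σ false isZero
σ-Reorders .<ᵇ-reorder zero    zero    0≢0 = contradiction refl 0≢0
σ-Reorders .<ᵇ-reorder zero    (suc j) _   = fromℕ-<ᵇ-inject₁ j
σ-Reorders .<ᵇ-reorder (suc i) zero    _   = inject₁-<ᵇ-fromℕ i
σ-Reorders .<ᵇ-reorder (suc i) (suc j) _   = inject₁-<ᵇ-inject₁ i j

ρ-Reorders : Reorders {n} ρ true (const false)
ρ-Reorders .<ᵇ-reorder zero    zero    0≢0 = contradiction refl 0≢0
ρ-Reorders .<ᵇ-reorder zero    (suc j) _   = fromℕ-<ᵇ-inject₁ (opposite j)
ρ-Reorders .<ᵇ-reorder (suc i) zero    _   = inject₁-<ᵇ-fromℕ (opposite i)
ρ-Reorders .<ᵇ-reorder (suc i) (suc j) i≢j =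
  trans (inject₁-<ᵇ-inject₁ (opposite i) (opposite j)) (ρ-Reorders .<ᵇ-reorder i j (i≢j ∘ cong suc))

σ-injective : Injective _≡_ _≡_ (σ {n})
σ-injective {x = zero}  {zero}  _  = refl
σ-injective {x = zero}  {suc j} eq = contradiction eq fromℕ≢inject₁
σ-injective {x = suc i} {zero}  eq = contradiction (sym eq) fromℕ≢inject₁
σ-injective {x = suc i} {suc j} eq = cong suc (inject₁-injective eq)

ρ-injective : Injective _≡_ _≡_ (ρ {n})
ρ-injective {x = x} {y} eq = trans (sym (opposite-involutive x)) (trans (cong opposite eq) (opposite-involutive y))

InD⇒injective : ∀ {g : Fin n → Fin n} → InD g → Injective _≡_ _≡_ g
InD⇒injective d-id      = id
InD⇒injective (d-σ g∈D) = InD⇒injective g∈D ∘ σ-injective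
InD⇒injective (d-ρ g∈D) = InD⇒injective g∈D ∘ ρ-injective

InD⇒Reorders : ∀ {g : Fin n → Fin n} → InD g → ∃₂ (Reorders g)
InD⇒Reorders d-id = false , const false , id-Reorders
InD⇒Reorders (d-σ g∈D) with InD⇒Reorders g∈D
... | _ , _ , g-reorders = _ , _ , ∘-Reorders (InD⇒injective g∈D) g-reorders σ-Reorders
InD⇒Reorders (d-ρ g∈D) with InD⇒Reorders g∈D
... | _ , _ , g-reorders = _ , _ , ∘-Reorders (InD⇒injective g∈D) g-reorders ρ-Reorders

Precedes : (Fin n → Fin n) → Fin n → Fin n → Set
Precedes τ u v = ∃₂ λ a b → τ a ≡ u × τ b ≡ v × toℕ a ℕ.< toℕ b

-- Only the neighbouring entries at positions i < j trade places, and they are not adjacent in Y.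
UAdj-preserves-Precedes : ∀ {Y : SimpleGraph n} {τ τ' u v} →
  UAdj Y τ τ' → Adj Y u v → Precedes τ u v → Precedes τ' u v
UAdj-preserves-Precedes {Y = Y} (i , j , j≡1+i , ¬τi~τj , τ'i , τ'j , τ'-fixed) u~v (a , b , τa≡u , τb≡v , a<b)
  with a ≟ i | a ≟ j
... | yes refl | _ = j , b , trans τ'j τa≡u , trans (τ'-fixed b b≢i b≢j) τb≡v , j<b
  where
  b≢i : b ≢ i
  b≢i refl = <-irrefl refl a<b
  b≢j : b ≢ j
  b≢j refl = ¬τi~τj (subst₂ (Adj Y) (sym τa≡u) (sym τb≡v) u~v)
  j<b : toℕ j ℕ.< toℕ b
  j<b = ≤∧≢⇒< (subst (ℕ._≤ toℕ b) (sym j≡1+i) a<b) (b≢j ∘ sym ∘ toℕ-injective)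
... | no _ | yes refl = i , b , trans τ'i τa≡u , trans (τ'-fixed b b≢i b≢j) τb≡v , <-trans i<j a<b
  where
  i<j : toℕ i ℕ.< toℕ j
  i<j = ≤-reflexive (sym j≡1+i)
  b≢i : b ≢ i
  b≢i refl = <-asym i<j a<b
  b≢j : b ≢ j
  b≢j refl = <-irrefl refl a<b
... | no a≢i | no a≢j with b ≟ i | b ≟ j
...   | yes refl | _ =
  a , j , trans (τ'-fixed a a≢i a≢j) τa≡u , trans τ'j τb≡v , <-trans a<b (≤-reflexive (sym j≡1+i))
...   | no _ | yes refl =
  a , i , trans (τ'-fixed a a≢i a≢j) τa≡u , trans τ'i τb≡v ,
  ≤∧≢⇒< (ℕ.s≤s⁻¹ (subst (ℕ.suc (toℕ a) ℕ.≤_) j≡1+i a<b)) (a≢i ∘ toℕ-injective)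
...   | no b≢i | no b≢j =
  a , b , trans (τ'-fixed a a≢i a≢j) τa≡u , trans (τ'-fixed b b≢i b≢j) τb≡v , a<b

SameClass-preserves-Precedes : ∀ {Y : SimpleGraph n} {τ τ' u v} →
  SameClass Y τ τ' → Adj Y u v → Precedes τ u v → Precedes τ' u v
SameClass-preserves-Precedes {Y = Y} {τ' = τ'} {u} {v} (ϱ , τ↝ϱ , ϱ≗τ') u~v = along τ↝ϱ
  where
  along : ∀ {κ} → Star (UAdj Y) κ ϱ → Precedes κ u v → Precedes τ' u v
  along ε (a , b , ϱa≡u , ϱb≡v , a<b) = a , b , trans (sym (ϱ≗τ' a)) ϱa≡u , trans (sym (ϱ≗τ' b)) ϱb≡v , a<b
  along (step ◅ steps) = along steps ∘ UAdj-preserves-Precedes {Y = Y} step u~v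

act-position : ∀ {π g gπ : Fin n → Fin n} → IsPerm π → Injective _≡_ _≡_ g → IsAct g π gπ →
  ∀ {p x} → gπ p ≡ π x → p ≡ g x
act-position π-inj g-inj act {p} gπp≡πx with injective⇒onto g-inj p
... | y , refl = cong _ (π-inj (trans (sym (act y)) gπp≡πx))

Precedes-act⇔< : ∀ {π g gπ : Fin n → Fin n} → IsPerm π → Injective _≡_ _≡_ g → IsAct g π gπ →
  ∀ {a b} → Precedes gπ (π a) (π b) ⇔ toℕ (g a) ℕ.< toℕ (g b)
Precedes-act⇔< π-inj g-inj act {a} {b} = mk⇔
  (λ (p , q , gπp≡πa , gπq≡πb , p<q) →
    subst₂ (λ p q → toℕ p ℕ.< toℕ q) (act-position π-inj g-inj act gπp≡πa) (act-position π-inj g-inj act gπq≡πb) p<q)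
  (λ ga<gb → _ , _ , act a , act b , ga<gb)

SameClass-act-<ᵇ : ∀ {Y : SimpleGraph n} {π g g' gπ g'π : Fin n → Fin n} → IsPerm π →
  Injective _≡_ _≡_ g → Injective _≡_ _≡_ g' → IsAct g π gπ → IsAct g' π g'π → SameClass Y gπ g'π →
  ∀ {a b} → Adj Y (π a) (π b) → (g a <ᵇ g b) ≡ (g' a <ᵇ g' b)
SameClass-act-<ᵇ {Y = Y} {π} {g} {g'} π-inj g-inj g'-inj act act' gπ∼g'π {a} {b} πa~πb =
  <ᵇ-transport ga≢gb (transfer πa~πb) (transfer (Adj-sym Y πa~πb))
  where
  transfer : ∀ {x y} → Adj Y (π x) (π y) → toℕ (g x) ℕ.< toℕ (g y) → toℕ (g' x) ℕ.< toℕ (g' y)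
  transfer πx~πy = Equivalence.to (Precedes-act⇔< π-inj g'-inj act')
                 ∘ SameClass-preserves-Precedes {Y = Y} gπ∼g'π πx~πy
                 ∘ Equivalence.from (Precedes-act⇔< π-inj g-inj act)
  ga≢gb : g a ≢ g b
  ga≢gb ga≡gb = irrefl Y (π b) (subst (λ z → Adj Y (π z) (π b)) (g-inj ga≡gb) πa~πb)

Reorders-agree⇔ : ∀ {g g' : Fin n → Fin n} {e e' c c'} → Reorders g e c → Reorders g' e' c' →
  ∀ {a b} → a ≢ b → (g a <ᵇ g b) ≡ (g' a <ᵇ g' b) ⇔ e xor e' ≡ (c a xor c' a) xor (c b xor c' b)
Reorders-agree⇔ {e = e} {e'} {c} {c'} g-reorders g'-reorders {a} {b} a≢b
  rewrite g-reorders .<ᵇ-reorder a b a≢b | g'-reorders .<ᵇ-reorder a b a≢b = mk⇔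
  (λ eq → xor-≡-false (trans (sym (xor-twists e e' (c a) (c' a) (c b) (c' b) (a <ᵇ b))) (≡⇒xor-≡-false eq)))
  (λ eq → xor-≡-false (trans (xor-twists e e' (c a) (c' a) (c b) (c' b) (a <ᵇ b)) (≡⇒xor-≡-false eq)))

module _ {π : Fin n → Fin n} (π-inj : IsPerm π) where

  π⁻¹ : Fin n → Fin n
  π⁻¹ = proj₁ ∘ injective⇒onto π-inj

  π∘π⁻¹ : ∀ u → π (π⁻¹ u) ≡ u
  π∘π⁻¹ = proj₂ ∘ injective⇒onto π-inj

  Adj-π⁻¹ : ∀ {Y : SimpleGraph n} {u v} → Adj Y u v → Adj Y (π (π⁻¹ u)) (π (π⁻¹ v))
  Adj-π⁻¹ {Y = Y} {u} {v} = subst₂ (Adj Y) (sym (π∘π⁻¹ u)) (sym (π∘π⁻¹ v))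

  cut⇒Bipartite : ∀ (Y : SimpleGraph n) (d : Fin n → Bool) →
    (∀ {a b} → Adj Y (π a) (π b) → d a xor d b ≡ true) → Bipartite Y
  cut⇒Bipartite Y d cut = d ∘ π⁻¹ , λ u v u~v → xor-≡-true (cut (Adj-π⁻¹ {Y = Y} u~v))

  uncut⇒constant : ∀ (Y : SimpleGraph n) → Connected Y → (d : Fin n → Bool) →
    (∀ {a b} → Adj Y (π a) (π b) → d a xor d b ≡ false) → ∀ a b → d a ≡ d b
  uncut⇒constant Y connected d uncut a b = begin
    d a             ≡⟨ cong d (π-inj (π∘π⁻¹ (π a))) ⟨
    d (π⁻¹ (π a))   ≡⟨ along (connected (π a) (π b)) ⟩
    d (π⁻¹ (π b))   ≡⟨ cong d (π-inj (π∘π⁻¹ (π b))) ⟩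
    d b             ∎
    where
    open ≡-Reasoning
    along : ∀ {u v} → Star (Adj Y) u v → d (π⁻¹ u) ≡ d (π⁻¹ v)
    along ε           = refl
    along (u~w ◅ w↝v) = trans (xor-≡-false (uncut (Adj-π⁻¹ {Y = Y} u~w))) (along w↝v)

edge-orders-agree⇒Bipartite : ∀ (Y : SimpleGraph n) → Connected Y → ∀ {π} → IsPerm π →
  ∀ {g g' e e' c c'} → Injective _≡_ _≡_ g → Injective _≡_ _≡_ g' → Reorders g e c → Reorders g' e' c' →
  (∀ {a b} → Adj Y (π a) (π b) → (g a <ᵇ g b) ≡ (g' a <ᵇ g' b)) → ¬ (∀ k → g k ≡ g' k) → Bipartite Y
edge-orders-agree⇒Bipartite {n} Y connected {π} π-inj {g} {g'} {e} {e'} {c} {c'} g-inj g'-inj g-reorders g'-reorders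
  edge-agree g≉g' = by-twist (e xor e') refl
  where
  d : Fin n → Bool
  d a = c a xor c' a
  π-distinct : ∀ {a b} → Adj Y (π a) (π b) → a ≢ b
  π-distinct πa~πa refl = irrefl Y _ πa~πa
  cut : ∀ {a b} → Adj Y (π a) (π b) → d a xor d b ≡ e xor e'
  cut πa~πb = sym (Equivalence.to (Reorders-agree⇔ g-reorders g'-reorders (π-distinct πa~πb)) (edge-agree πa~πb))
  by-twist : ∀ t → e xor e' ≡ t → Bipartite Y
  by-twist true  twisted = cut⇒Bipartite π-inj Y d (λ πa~πb → trans (cut πa~πb) twisted)
  by-twist false aligned = contradiction (<ᵇ-determines g-inj g'-inj same-order) g≉g'
    where
    d-constant : ∀ a b → d a ≡ d b
    d-constant = uncut⇒constant π-inj Y connected d (λ πa~πb → trans (cut πa~πb) aligned)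
    same-order : ∀ a b → (g a <ᵇ g b) ≡ (g' a <ᵇ g' b)
    same-order a b with a ≟ b
    ... | yes refl = trans (<ᵇ-irrefl (g a)) (sym (<ᵇ-irrefl (g' a)))
    ... | no  a≢b  = Equivalence.from (Reorders-agree⇔ g-reorders g'-reorders a≢b)
                       (trans aligned (sym (≡⇒xor-≡-false (d-constant a b))))

proposition2 : ∀ {n : ℕ} (Y : SimpleGraph n) → Connected Y →
    (π : Fin n → Fin n) → IsPerm π →
    (g g' : Fin n → Fin n) → InD g → InD g' → ¬ (∀ k → g k ≡ g' k) →
    (gπ g'π : Fin n → Fin n) → IsAct g π gπ → IsAct g' π g'π →
    SameClass Y gπ g'π → Bipartite Y
proposition2 Y connected π π-inj g g' g∈D g'∈D g≉g' gπ g'π act act' gπ∼g'π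
  with InD⇒Reorders g∈D | InD⇒Reorders g'∈D
... | _ , _ , g-reorders | _ , _ , g'-reorders =
  edge-orders-agree⇒Bipartite Y connected π-inj g-inj g'-inj g-reorders g'-reorders
    (SameClass-act-<ᵇ {Y = Y} π-inj g-inj g'-inj act act' gπ∼g'π) g≉g'
  where
  g-inj : Injective _≡_ _≡_ g
  g-inj = InD⇒injective g∈D
  g'-inj : Injective _≡_ _≡_ g'
  g'-inj = InD⇒injective g'∈D
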